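{- Let $(\Sigma,\Gamma,\mathcal U)$ be an extended many-sorted finite model finding problem with a sort $A$. Let $X\subseteq\mathcal U(A)$ be a value-interchangeable set for $A$, enumerated as $a_1,\dots,a_m$ (distinct). Let $c_1,\dots,c_n$ be constant symbols of $\Sigma$ of sort $A$, and let $I$ be any interpretation of $(\Sigma,\Gamma,\mathcal U)$. Then there exists an interpretation $I'$ isomorphic to $I$ such that: (1) for $k=1,\dots,\min\{m,n\}$, $I'$ satisfies $\left(\bigvee_{i=1}^k c_k=a_i\right)\lor\left(\bigvee_{a\in\mathcal U(A)\setminus X} c_k=a\right)$, i.e. $I'(c_k)\in\{a_1,\dots,a_k\}\cup(\mathcal U(A)\setminus X)$; and (2) for $k=2,\dots,\min\{m,n\}$ and $d=2,\dots,k$, $I'$ satisfies $(c_k=a_d)\implies\bigvee_{i=1}^{k-1}c_i=a_{d-1}$.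
   Context: A signature $\Sigma$ consists of a finite set of sorts, a finite set of function symbols $g:A_1\times\dots\times A_n\to B$ (constants when $n=0$), and a finite set of predicate symbols $R:A_1\times\dots\times A_n\to\mathrm{Bool}$. A domain assignment $\mathcal U$ maps each sort to a nonempty finite set. An extended MSFMF problem is $(\Sigma,\Gamma,\mathcal U)$ where $\Gamma$ is a finite set of many-sorted first-order formulas (with equality) over $\Sigma$ in which, additionally, every domain value $v\in\mathcal U(\theta)$ may be used as a term of sort $\theta$ (evaluating to itself). An interpretation $I$ assigns each function symbol $g:A_1\times\dots\times A_n\to B$ a function $\mathcal U(A_1)\times\dots\times\mathcal U(A_n)\to\mathcal U(B)$ and each predicate symbol a relation on the corresponding product of domains; $I\models\Gamma$ means $I$ satisfies every formula of $\Gamma$. A domain permutation $\sigma$ is a family of permutations $\sigma_\theta$ of $\mathcal U(\theta)$, one per sort; it acts by $(\sigma\bullet I)(g)(\sigma_{A_1}(a_1),\dots,\sigma_{A_n}(a_n))=\sigma_B(I(g)(a_1,\dots,a_n))$ and $(a_1,\dots,a_n)\in I(R)\iff(\sigma_{A_1}(a_1),\dots,\sigma_{A_n}(a_n))\in(\sigma\bullet I)(R)$. A domain symmetry is a domain permutation $\sigma$ such that for every interpretation $I$, $\sigma\bullet I\models\Gamma$ iff $I\models\Gamma$. Interpretations $I,I'$ are isomorphic if $I'=\sigma\bullet I$ for some domain symmetry $\sigma$. A set $X\subseteq\mathcal U(\theta)$ is value-interchangeable for $\theta$ if every domain permutation $\sigma$ with $\sigma_\theta(v)=v$ for all $v\in\mathcal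 U(\theta)\setminus X$ and $\sigma_{\theta'}$ the identity for all sorts $\theta'\neq\theta$ is a domain symmetry. -}

module Defs where

open import Data.Nat using (ℕ; zero; suc; _<_; _≤_; NonZero)
open import Data.Fin using (Fin; toℕ)
open import Data.Fin.Permutation using (Permutation′; _⟨$⟩ʳ_; _⟨$⟩ˡ_)
open import Data.List using (List; []; _∷_)
open import Data.List.Relation.Unary.All using (All)
open import Data.Bool using (Bool; true)
open import Data.Unit using (⊤; tt)
open import Data.Product using (Σ; ∃; _×_; _,_)
open import Data.Sum using (_⊎_)
open import Relation.Nullary using (¬_)
open import Relation.Binary.PropositionalEquality using (_≡_; _≢_; subst; sym)

-- A many-sorted signature: sorts are Fin nSorts, function symbols Fin nFun
-- (constants = empty argument list), predicate symbols Fin nPred.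
record Signature : Set where
  field
    nSorts   : ℕ
    nFun     : ℕ
    funArgs  : Fin nFun → List (Fin nSorts)
    funRes   : Fin nFun → Fin nSorts
    nPred    : ℕ
    predArgs : Fin nPred → List (Fin nSorts)

  Sort : Set
  Sort = Fin nSorts

  FunSym : Set
  FunSym = Fin nFun

  PredSym : Set
  PredSym = Fin nPred

module MSFMF (Sig : Signature) (U : Signature.Sort Sig → ℕ) where
  open Signature Sig public

  Dom : Sort → Set
  Dom θ = Fin (U θ)

  Args : List Sort → Set
  Args []       = ⊤
  Args (θ ∷ as) = Dom θ × Args as

  record Interp : Set where
    field
      fun  : (g : FunSym) → Args (funArgs g) → Dom (funRes g)
      pred : (R : PredSym) → Args (predArgs R) → Bool

  data Var : List Sort → Sort → Set where
    here  : ∀ {θ ctx} → Var (θ ∷ ctx) θ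
    there : ∀ {θ θ' ctx} → Var ctx θ → Var (θ' ∷ ctx) θ

  mutual
    data Term (ctx : List Sort) : Sort → Set where
      var : ∀ {θ} → Var ctx θ → Term ctx θ
      app : (g : FunSym) → Terms ctx (funArgs g) → Term ctx (funRes g)
      val : ∀ {θ} → Dom θ → Term ctx θ

    data Terms (ctx : List Sort) : List Sort → Set where
      []  : Terms ctx []
      _∷_ : ∀ {θ as} → Term ctx θ → Terms ctx as → Terms ctx (θ ∷ as)

  data Formula (ctx : List Sort) : Set where
    _≐_    : ∀ {θ} → Term ctx θ → Term ctx θ → Formula ctx
    pred   : (R : PredSym) → Terms ctx (predArgs R) → Formula ctx
    ⊤f ⊥f  : Formula ctx
    ¬f_    : Formula ctx → Formula ctx
    _∧f_ _∨f_ _⇒f_ : Formula ctx → Formula ctx → Formula ctx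
    ∀f ∃f  : (θ : Sort) → Formula (θ ∷ ctx) → Formula ctx

  Sentence : Set
  Sentence = Formula []

  lookupVar : ∀ {ctx θ} → Var ctx θ → Args ctx → Dom θ
  lookupVar here      (v , _) = v
  lookupVar (there x) (_ , ρ) = lookupVar x ρ

  mutual
    evalTerm : Interp → ∀ {ctx θ} → Term ctx θ → Args ctx → Dom θ
    evalTerm I (var x)    ρ = lookupVar x ρ
    evalTerm I (app g ts) ρ = Interp.fun I g (evalTerms I ts ρ)
    evalTerm I (val v)    ρ = v

    evalTerms : Interp → ∀ {ctx as} → Terms ctx as → Args ctx → Args as
    evalTerms I []       ρ = tt
    evalTerms I (t ∷ ts) ρ = evalTerm I t ρ , evalTerms I ts ρ

  Sat : Interp → ∀ {ctx} → Formula ctx → Args ctx → Set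
  Sat I (t ≐ u)    ρ = evalTerm I t ρ ≡ evalTerm I u ρ
  Sat I (pred R ts) ρ = Interp.pred I R (evalTerms I ts ρ) ≡ true
  Sat I ⊤f         ρ = ⊤
  Sat I ⊥f         ρ = ¬ ⊤
  Sat I (¬f φ)     ρ = ¬ Sat I φ ρ
  Sat I (φ ∧f ψ)   ρ = Sat I φ ρ × Sat I ψ ρ
  Sat I (φ ∨f ψ)   ρ = Sat I φ ρ ⊎ Sat I ψ ρ
  Sat I (φ ⇒f ψ)   ρ = Sat I φ ρ → Sat I ψ ρ
  Sat I (∀f θ φ)   ρ = (v : Dom θ) → Sat I φ (v , ρ)
  Sat I (∃f θ φ)   ρ = Σ (Dom θ) λ v → Sat I φ (v , ρ)

  _⊨_ : Interp → List Sentence → Set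
  I ⊨ Γ = All (λ φ → Sat I φ tt) Γ

  DomPerm : Set
  DomPerm = (θ : Sort) → Permutation′ (U θ)

  mapArgs : (∀ θ → Dom θ → Dom θ) → ∀ {as} → Args as → Args as
  mapArgs f {[]}     tt      = tt
  mapArgs f {θ ∷ as} (v , ρ) = f θ v , mapArgs f ρ

  -- (σ • I)(g)(σ(a)) = σ(I(g)(a)),  a ∈ I(R) ⇔ σ(a) ∈ (σ • I)(R)
  _•_ : DomPerm → Interp → Interp
  Interp.fun  (σ • I) g b = σ (funRes g) ⟨$⟩ʳ Interp.fun I g (mapArgs (λ θ v → σ θ ⟨$⟩ˡ v) b)
  Interp.pred (σ • I) R b = Interp.pred I R (mapArgs (λ θ v → σ θ ⟨$⟩ˡ v) b)

  DomainSymmetry : List Sentence → DomPerm → Set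
  DomainSymmetry Γ σ = (I : Interp) → ((σ • I) ⊨ Γ → I ⊨ Γ) × (I ⊨ Γ → (σ • I) ⊨ Γ)

  _≈I_ : Interp → Interp → Set
  I ≈I J = (∀ g b → Interp.fun I g b ≡ Interp.fun J g b)
         × (∀ R b → Interp.pred I R b ≡ Interp.pred J R b)

  Isomorphic : List Sentence → Interp → Interp → Set
  Isomorphic Γ I I' = Σ DomPerm λ σ → DomainSymmetry Γ σ × (I' ≈I (σ • I))

  ValueInterchangeable : List Sentence → (A : Sort) → (Dom A → Set) → Set
  ValueInterchangeable Γ A X =
    (σ : DomPerm) →
    (∀ v → ¬ X v → σ A ⟨$⟩ʳ v ≡ v) →
    (∀ θ → θ ≢ A → ∀ v → σ θ ⟨$⟩ʳ v ≡ v) →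
    DomainSymmetry Γ σ

  constVal : Interp → (A : Sort) → (g : FunSym) → funArgs g ≡ [] → funRes g ≡ A → Dom A
  constVal I A g p q = subst Dom q (Interp.fun I g (subst Args (sym p) tt))

-- Run through c₁, c₂, … in order, keeping a permutation π of U(A) that moves only values of X and
-- under which the values of X taken so far are a₁, …, a_r, first taken in exactly this order. When
-- c_k takes a value of X not yet taken, compose π with the transposition of that value and a_{r+1};
-- neither is the value of an earlier constant, so those values stay put. Extended by the identity on
-- the other sorts, π is a domain symmetry by value-interchangeability.
module Submission where

open import Defs
open import Data.Nat using (ℕ; zero; suc; _<_; _≤_; z≤n; s≤s; NonZero)
open import Data.Nat.Properties
  using (≤-refl; <⇒≤; <⇒≢; <-≤-trans; ≤-<-trans; <-trans; n≮n; n<1+n;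
         m<n⇒m<1+n; m≤n⇒m≤1+n; m≤n⇒m<n∨m≡n; ≤-pred; ≮⇒≥; _<?_)
open import Data.Fin using (Fin; toℕ; fromℕ<; _≟_)
open import Data.Fin.Properties using (toℕ-fromℕ<; toℕ-injective; toℕ<n; any?)
open import Data.Fin.Permutation using (Permutation′; _⟨$⟩ʳ_; _⟨$⟩ˡ_; id; _∘ₚ_; transpose)
import Data.Fin.Permutation.Components as PC
open import Data.List using (List; [])
open import Data.Product using (Σ; ∃; _×_; _,_; proj₁; proj₂)
open import Data.Sum using (_⊎_; inj₁; inj₂)
open import Data.Empty using (⊥-elim)
open import Data.Unit using (tt)
open import Function.Definitions using (Injective)
open import Relation.Nullary using (¬_; yes; no)
open import Relation.Binary.PropositionalEquality
  using (_≡_; _≢_; _≗_; refl; sym; trans; cong; subst; subst₂)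

transpose-matchˡ : ∀ {N} (x y : Fin N) → PC.transpose x y x ≡ y
transpose-matchˡ x y with x ≟ x
... | yes _   = refl
... | no x≢x = ⊥-elim (x≢x refl)

transpose-other : ∀ {N} {x y k : Fin N} → k ≢ x → k ≢ y → PC.transpose x y k ≡ k
transpose-other {x = x} {y} {k} k≢x k≢y with k ≟ x
... | yes k≡x = ⊥-elim (k≢x k≡x)
... | no _ with k ≟ y
...   | yes k≡y = ⊥-elim (k≢y k≡y)
...   | no _    = refl

module FirstOccurrence {N m : ℕ} (a : Fin m → Fin N) where

  InX : Fin N → Set
  InX v = ∃ λ i → a i ≡ v

  Outside : Fin N → Set
  Outside v = ∀ i → a i ≢ v

  IntroducedBy : ∀ {n} → (Fin n → Fin N) → Fin n → Set
  IntroducedBy v k = (Σ (Fin m) λ i → toℕ i ≤ toℕ k × v k ≡ a i) ⊎ Outside (v k)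

  HasPredecessor : ∀ {n} → (Fin n → Fin N) → Fin n → Set
  HasPredecessor {n} v k = ∀ (d d' : Fin m) → toℕ d ≡ suc (toℕ d') → v k ≡ a d →
                           Σ (Fin n) λ i → toℕ i < toℕ k × v i ≡ a d'

  record Canonical {n} (v : Fin n → Fin N) : Set where
    field
      introduced  : ∀ k → IntroducedBy v k
      predecessor : ∀ k → HasPredecessor v k

  ≗-canonical : ∀ {n} {u v : Fin n → Fin N} → u ≗ v → Canonical v → Canonical u
  ≗-canonical {u = u} {v} u≗v can = record { introduced = introduced′ ; predecessor = predecessor′ }
    where
    open Canonical can
    introduced′ : ∀ k → IntroducedBy u k
    introduced′ k with introduced k
    ... | inj₁ (i , i≤k , vk≡ai) = inj₁ (i , i≤k , trans (u≗v k) vk≡ai)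
    ... | inj₂ out = inj₂ (λ i ai≡uk → out i (trans ai≡uk (u≗v k)))
    predecessor′ : ∀ k → HasPredecessor u k
    predecessor′ k d d' d≡1+d' uk≡ad =
      let (i , i<k , vi≡ad') = predecessor k d d' d≡1+d' (trans (sym (u≗v k)) uk≡ad)
      in i , i<k , trans (u≗v i) vi≡ad'

module Canonisation {N m : ℕ} (a : Fin m → Fin N) (a-injective : Injective _≡_ _≡_ a)
                    {n : ℕ} (w : Fin n → Fin N) where
  open FirstOccurrence a

  relabel : Permutation′ N → Fin n → Fin N
  relabel π j = π ⟨$⟩ʳ w j

  BoundedBy : ℕ → Permutation′ N → Fin n → Set
  BoundedBy used π j =
    (Σ (Fin m) λ i → toℕ i ≤ toℕ j × toℕ i < used × relabel π j ≡ a i) ⊎ Outside (relabel π j)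

  -- The values of X taken by the first k relabelled constants are exactly a₀, …, a_{used-1}.
  record CanonicalPrefix (k : ℕ) : Set where
    field
      π           : Permutation′ N
      used        : ℕ
      used≤k      : used ≤ k
      fixes       : ∀ v → ¬ InX v → π ⟨$⟩ʳ v ≡ v
      bounded     : ∀ j → toℕ j < k → BoundedBy used π j
      covered     : ∀ i → toℕ i < used → Σ (Fin n) λ j → toℕ j < k × relabel π j ≡ a i
      predecessor : ∀ j → toℕ j < k → HasPredecessor (relabel π) j

  empty : CanonicalPrefix 0
  empty = record { π = id ; used = 0 ; used≤k = z≤n ; fixes = λ _ _ → refl
                 ; bounded = λ _ () ; covered = λ _ () ; predecessor = λ _ () }

  module Extend {k : ℕ} (k<n : k < n) (prefix : CanonicalPrefix k) where
    open CanonicalPrefix prefix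

    K : Fin n
    K = fromℕ< k<n

    toℕ-K : toℕ K ≡ k
    toℕ-K = toℕ-fromℕ< k<n

    earlier-or-K : ∀ j → toℕ j < suc k → toℕ j < k ⊎ j ≡ K
    earlier-or-K j j<1+k with m≤n⇒m<n∨m≡n (≤-pred j<1+k)
    ... | inj₁ j<k = inj₁ j<k
    ... | inj₂ j≡k = inj₂ (toℕ-injective (trans j≡k (sym toℕ-K)))

    covered-suc : ∀ i → toℕ i < used → Σ (Fin n) λ j → toℕ j < suc k × relabel π j ≡ a i
    covered-suc i i<used = let (j , j<k , eq) = covered i i<used in j , m<n⇒m<1+n j<k , eq

    outsideX : Outside (relabel π K) → CanonicalPrefix (suc k)
    outsideX out = record { π = π ; used = used ; used≤k = m≤n⇒m≤1+n used≤k ; fixes = fixes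
                          ; bounded = bounded′ ; covered = covered-suc ; predecessor = predecessor′ }
      where
      bounded′ : ∀ j → toℕ j < suc k → BoundedBy used π j
      bounded′ j j<1+k with earlier-or-K j j<1+k
      ... | inj₁ j<k = bounded j j<k
      ... | inj₂ refl = inj₂ out
      predecessor′ : ∀ j → toℕ j < suc k → HasPredecessor (relabel π) j
      predecessor′ j j<1+k d d' d≡1+d' eq with earlier-or-K j j<1+k
      ... | inj₁ j<k = predecessor j j<k d d' d≡1+d' eq
      ... | inj₂ refl = ⊥-elim (out d (sym eq))

    oldValue : ∀ i → toℕ i < used → a i ≡ relabel π K → CanonicalPrefix (suc k)
    oldValue i i<used ai≡πK =
      record { π = π ; used = used ; used≤k = m≤n⇒m≤1+n used≤k ; fixes = fixes
             ; bounded = bounded′ ; covered = covered-suc ; predecessor = predecessor′ }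
      where
      bounded′ : ∀ j → toℕ j < suc k → BoundedBy used π j
      bounded′ j j<1+k with earlier-or-K j j<1+k
      ... | inj₁ j<k = bounded j j<k
      ... | inj₂ refl =
        inj₁ (i , subst (toℕ i ≤_) (sym toℕ-K) (<⇒≤ (<-≤-trans i<used used≤k)) , i<used , sym ai≡πK)
      predecessor′ : ∀ j → toℕ j < suc k → HasPredecessor (relabel π) j
      predecessor′ j j<1+k d d' d≡1+d' eq with earlier-or-K j j<1+k
      ... | inj₁ j<k = predecessor j j<k d d' d≡1+d' eq
      ... | inj₂ refl with a-injective (trans ai≡πK eq)
      ...   | refl =
        let d'<used = <-trans (subst (toℕ d' <_) (sym d≡1+d') (n<1+n _)) i<used
            (j' , j'<k , eq′) = covered d' d'<used
        in j' , subst (toℕ j' <_) (sym toℕ-K) j'<k , eq′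

    newValue : ∀ i → used ≤ toℕ i → a i ≡ relabel π K → CanonicalPrefix (suc k)
    newValue i used≤i ai≡πK =
      record { π = π′ ; used = suc used ; used≤k = s≤s used≤k ; fixes = fixes′
             ; bounded = bounded′ ; covered = covered′ ; predecessor = predecessor′ }
      where
      R : Fin m
      R = fromℕ< (≤-<-trans used≤i (toℕ<n i))
      toℕ-R : toℕ R ≡ used
      toℕ-R = toℕ-fromℕ< (≤-<-trans used≤i (toℕ<n i))
      π′ : Permutation′ N
      π′ = π ∘ₚ transpose (a i) (a R)
      a-distinct : ∀ {t u} → toℕ t ≢ toℕ u → a t ≢ a u
      a-distinct t≢u at≡au = t≢u (cong toℕ (a-injective at≡au))
      -- the swap only moves values no earlier constant takes
      unchanged : ∀ j → toℕ j < k → relabel π′ j ≡ relabel π j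
      unchanged j j<k with bounded j j<k
      ... | inj₁ (t , _ , t<used , πj≡at) =
        trans (cong (PC.transpose (a i) (a R)) πj≡at) (trans (transpose-other at≢ai at≢aR) (sym πj≡at))
        where
        at≢ai : a t ≢ a i
        at≢ai = a-distinct λ t≡i → n≮n _ (<-≤-trans t<used (subst (used ≤_) (sym t≡i) used≤i))
        at≢aR : a t ≢ a R
        at≢aR = a-distinct λ t≡R → <⇒≢ t<used (trans t≡R toℕ-R)
      ... | inj₂ out = transpose-other (λ eq → out i (sym eq)) (λ eq → out R (sym eq))
      fixes′ : ∀ v → ¬ InX v → π′ ⟨$⟩ʳ v ≡ v
      fixes′ v v∉X rewrite fixes v v∉X =
        transpose-other (λ eq → v∉X (i , sym eq)) (λ eq → v∉X (R , sym eq))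
      π′K≡aR : relabel π′ K ≡ a R
      π′K≡aR = subst (λ x → PC.transpose (a i) (a R) x ≡ a R) ai≡πK (transpose-matchˡ (a i) (a R))
      bounded′ : ∀ j → toℕ j < suc k → BoundedBy (suc used) π′ j
      bounded′ j j<1+k with earlier-or-K j j<1+k
      ... | inj₂ refl =
        inj₁ (R , subst₂ _≤_ (sym toℕ-R) (sym toℕ-K) used≤k
                , subst (_< suc used) (sym toℕ-R) (n<1+n used) , π′K≡aR)
      ... | inj₁ j<k with bounded j j<k
      ...   | inj₁ (t , t≤j , t<used , eq) =
        inj₁ (t , t≤j , m<n⇒m<1+n t<used , trans (unchanged j j<k) eq)
      ...   | inj₂ out = inj₂ (λ t eq → out t (trans eq (unchanged j j<k)))
      covered′ : ∀ t → toℕ t < suc used → Σ (Fin n) λ j → toℕ j < suc k × relabel π′ j ≡ a t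
      covered′ t t<1+used with m≤n⇒m<n∨m≡n (≤-pred t<1+used)
      ... | inj₁ t<used =
        let (j , j<k , eq) = covered t t<used in j , m<n⇒m<1+n j<k , trans (unchanged j j<k) eq
      ... | inj₂ t≡used with toℕ-injective {i = t} {j = R} (trans t≡used (sym toℕ-R))
      ...   | refl = K , subst (_< suc k) (sym toℕ-K) (n<1+n k) , π′K≡aR
      predecessor′ : ∀ j → toℕ j < suc k → HasPredecessor (relabel π′) j
      predecessor′ j j<1+k d d' d≡1+d' eq with earlier-or-K j j<1+k
      ... | inj₁ j<k =
        let (i′ , i′<j , eq′) = predecessor j j<k d d' d≡1+d' (trans (sym (unchanged j j<k)) eq)
        in i′ , i′<j , trans (unchanged i′ (<-trans i′<j j<k)) eq′
      ... | inj₂ refl with a-injective (trans (sym π′K≡aR) eq)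
      ...   | refl =
        let (j' , j'<k , eq′) = covered d' (subst (toℕ d' <_) (trans (sym d≡1+d') toℕ-R) (n<1+n _))
        in j' , subst (toℕ j' <_) (sym toℕ-K) j'<k , trans (unchanged j' j'<k) eq′

    extended : CanonicalPrefix (suc k)
    extended with any? (λ i → a i ≟ relabel π K)
    ... | no ∉X = outsideX (λ i eq → ∉X (i , eq))
    ... | yes (i , eq) with toℕ i <? used
    ...   | yes i<used = oldValue i i<used eq
    ...   | no i≮used = newValue i (≮⇒≥ i≮used) eq

  canonicalPrefix : ∀ k → k ≤ n → CanonicalPrefix k
  canonicalPrefix zero    _     = empty
  canonicalPrefix (suc k) k<n = Extend.extended k<n (canonicalPrefix k (<⇒≤ k<n))

  canonise : Σ (Permutation′ N) λ π → (∀ v → ¬ InX v → π ⟨$⟩ʳ v ≡ v) × Canonical (relabel π)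
  canonise =
    π , fixes , record { introduced = introduced ; predecessor = λ j → predecessor j (toℕ<n j) }
    where
    open CanonicalPrefix (canonicalPrefix n ≤-refl)
    introduced : ∀ j → IntroducedBy (relabel π) j
    introduced j with bounded j (toℕ<n j)
    ... | inj₁ (i , i≤j , _ , eq) = inj₁ (i , i≤j , eq)
    ... | inj₂ out = inj₂ out

module OnOneSort (Sig : Signature) (U : Signature.Sort Sig → ℕ) where
  open MSFMF Sig U

  onSort : (A : Sort) → Permutation′ (U A) → DomPerm
  onSort A π θ with θ ≟ A
  ... | yes refl = π
  ... | no _     = id

  onSort-self : ∀ A π v → onSort A π A ⟨$⟩ʳ v ≡ π ⟨$⟩ʳ v
  onSort-self A π v with A ≟ A
  ... | yes refl = refl
  ... | no A≢A   = ⊥-elim (A≢A refl)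

  onSort-other : ∀ A π θ → θ ≢ A → ∀ v → onSort A π θ ⟨$⟩ʳ v ≡ v
  onSort-other A π θ θ≢A v with θ ≟ A
  ... | yes θ≡A = ⊥-elim (θ≢A θ≡A)
  ... | no _    = refl

  constVal-• : ∀ σ I A g (p : funArgs g ≡ []) (q : funRes g ≡ A) →
               constVal (σ • I) A g p q ≡ σ A ⟨$⟩ʳ constVal I A g p q
  constVal-• σ I A g p q =
    trans (cong (λ b → subst Dom q (σ (funRes g) ⟨$⟩ʳ Interp.fun I g b)) (mapArgs-empty (funArgs g) p))
          (subst-⟨$⟩ʳ (funRes g) q _)
    where
    mapArgs-empty : ∀ as (p : as ≡ []) →
                    mapArgs (λ θ v → σ θ ⟨$⟩ˡ v) {as} (subst Args (sym p) tt) ≡ subst Args (sym p) tt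
    mapArgs-empty .[] refl = refl
    subst-⟨$⟩ʳ : ∀ θ (q : θ ≡ A) x → subst Dom q (σ θ ⟨$⟩ʳ x) ≡ σ A ⟨$⟩ʳ subst Dom q x
    subst-⟨$⟩ʳ θ refl x = refl

mainTheorem9 : (Sig : Signature) (U : Signature.Sort Sig → ℕ) →
    (∀ θ → NonZero (U θ)) →
    (Γ : List (MSFMF.Sentence Sig U)) →
    (A : Signature.Sort Sig) →
    (m : ℕ) (a : Fin m → MSFMF.Dom Sig U A) → Injective _≡_ _≡_ a →
    MSFMF.ValueInterchangeable Sig U Γ A (λ v → ∃ λ i → a i ≡ v) →
    (n : ℕ) (c : Fin n → Signature.FunSym Sig) →
    (cArgs : ∀ k → Signature.funArgs Sig (c k) ≡ []) →
    (cRes : ∀ k → Signature.funRes Sig (c k) ≡ A) →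
    (I : MSFMF.Interp Sig U) →
    Σ (MSFMF.Interp Sig U) λ I' →
      MSFMF.Isomorphic Sig U Γ I I'
      × (∀ (k : Fin n) → toℕ k < m →
           (Σ (Fin m) λ i → toℕ i ≤ toℕ k
              × MSFMF.constVal Sig U I' A (c k) (cArgs k) (cRes k) ≡ a i)
           ⊎ (∀ (i : Fin m) → a i ≢ MSFMF.constVal Sig U I' A (c k) (cArgs k) (cRes k)))
      × (∀ (k : Fin n) → toℕ k < m →
           ∀ (d d' : Fin m) → toℕ d ≡ suc (toℕ d') → toℕ d ≤ toℕ k →
           MSFMF.constVal Sig U I' A (c k) (cArgs k) (cRes k) ≡ a d →
           Σ (Fin n) λ i → toℕ i < toℕ k
              × MSFMF.constVal Sig U I' A (c i) (cArgs i) (cRes i) ≡ a d')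
mainTheorem9 Sig U _ Γ A m a a-injective interchangeable n c cArgs cRes I =
  σ • I , (σ , symmetry , (λ _ _ → refl) , (λ _ _ → refl))
  , (λ k _ → introduced k) , (λ k _ d d' d≡1+d' _ → predecessor k d d' d≡1+d')
  where
  open MSFMF Sig U
  open OnOneSort Sig U
  open FirstOccurrence a

  value : Interp → Fin n → Dom A
  value J k = constVal J A (c k) (cArgs k) (cRes k)

  open Canonisation a a-injective (value I)

  π : Permutation′ (U A)
  π = proj₁ canonise

  σ : DomPerm
  σ = onSort A π

  symmetry : DomainSymmetry Γ σ
  symmetry = interchangeable σ (λ v v∉X → trans (onSort-self A π v) (proj₁ (proj₂ canonise) v v∉X))
                             (onSort-other A π)

  value-σ•I : value (σ • I) ≗ relabel π
  value-σ•I k = trans (constVal-• σ I A (c k) (cArgs k) (cRes k)) (onSort-self A π (value I k))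

  open Canonical (≗-canonical value-σ•I (proj₂ (proj₂ canonise)))
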